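{- Let $i \ge 7$ be an integer. Consider the Missionaries and Cannibals puzzle with $M=i$ missionaries, $C=i$ cannibals, boat capacity $B=4$ and safety margin $d=0$ (as defined in the context). Then the number of solutions, i.e. the number of shortest walks in the state graph from the initial state $[i,i,1]$ to the final state $[0,0,0]$, is exactly $361$.
   Context: The generalized Missionaries and Cannibals puzzle with parameters $M,C,B,d$: $M$ missionaries and $C$ cannibals start on the first bank of a river and must all cross to the second bank using a boat that carries at least $1$ and at most $B$ people (it cannot cross empty). A state is a triple $[m,c,b]$ of integers with $0\le m\le M$, $0\le c\le C$, $b\in\{0,1\}$, where $m$ and $c$ are the numbers of missionaries and cannibals on the first bank and $b=1$ if the boat is at the first bank, $b=0$ if at the second bank. A state is legal if: whenever $m>0$ and $c>0$ then $m-c\ge d$, and whenever $M-m>0$ and $C-c>0$ then $(M-m)-(C-c)\ge d$. The state graph is the directed graph on legal states with edges $[m,c,1]\to[m-e_1,c-e_2,0]$ and $[m,c,0]\to[m+e_1,c+e_2,1]$ for nonnegative integers $e_1,e_2$ with $0<e_1+e_2\le B$, both endpoints legal, and such that if $e_1>0$ and $e_2>0$ then $e_1-e_2\ge d$ (the boat carries $e_1$ missionaries and $e_2$ cannibals). A solution of the puzzle is a shortest (minimum number of crossings) directed walk in the state graph from $[M,C,1]$ to $[0,0,0]$. -}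

module Defs where

open import Data.Nat using (ℕ; zero; suc; _+_; _∸_; _≤_; _<_)
open import Data.Integer as ℤ using (ℤ; +_)
open import Data.Bool using (Bool; true; false)
open import Data.Product using (Σ; _×_; _,_)
open import Data.Sum using (_⊎_)
open import Data.List using (List; []; _∷_; length)
open import Data.List.Relation.Unary.Unique.Propositional using (Unique)
open import Data.List.Membership.Propositional using (_∈_)
open import Relation.Binary.PropositionalEquality using (_≡_)

-- A state [m , c , b]: m missionaries and c cannibals on the first bank;
-- b = true  means the boat is at the first bank  (b = 1 in the paper),
-- b = false means the boat is at the second bank (b = 0 in the paper).
record State : Set where
  constructor [_,_,_]
  field
    m : ℕ
    c : ℕ
    b : Bool
open State public

Legal : (M C : ℕ) (d : ℤ) → State → Set
Legal M C d s =
  m s ≤ M × c s ≤ C ×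
  (0 < m s → 0 < c s → d ℤ.≤ (+ m s) ℤ.- (+ c s)) ×
  (0 < M ∸ m s → 0 < C ∸ c s → d ℤ.≤ (+ (M ∸ m s)) ℤ.- (+ (C ∸ c s)))

Load : (B : ℕ) (d : ℤ) (e₁ e₂ : ℕ) → Set
Load B d e₁ e₂ =
  0 < e₁ + e₂ × e₁ + e₂ ≤ B × (0 < e₁ → 0 < e₂ → d ℤ.≤ (+ e₁) ℤ.- (+ e₂))

Edge : (M C B : ℕ) (d : ℤ) → State → State → Set
Edge M C B d s t =
  Legal M C d s × Legal M C d t ×
  Σ ℕ λ e₁ → Σ ℕ λ e₂ → Load B d e₁ e₂ ×
    ( (b s ≡ true × b t ≡ false × m s ≡ m t + e₁ × c s ≡ c t + e₂)
    ⊎ (b s ≡ false × b t ≡ true × m t ≡ m s + e₁ × c t ≡ c s + e₂))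

data Walk (E : State → State → Set) : State → State → List State → Set where
  here  : ∀ {s} → Walk E s s (s ∷ [])
  there : ∀ {s u t xs} → E s u → Walk E u t xs → Walk E s t (s ∷ xs)

crossings : List State → ℕ
crossings xs = length xs ∸ 1

start : ℕ → ℕ → State
start M C = [ M , C , true ]

goal : State
goal = [ 0 , 0 , false ]

NumSolutions : (M C B : ℕ) (d : ℤ) (k : ℕ) → Set
NumSolutions M C B d k =
  Σ ℕ λ L →
    (∀ xs → Walk (Edge M C B d) (start M C) goal xs → L ≤ crossings xs) ×
    Σ (List (List State)) λ ws →
      Unique ws ×
      (∀ xs → xs ∈ ws → Walk (Edge M C B d) (start M C) goal xs × crossings xs ≡ L) ×
      (∀ xs → Walk (Edge M C B d) (start M C) goal xs → crossings xs ≡ L → xs ∈ ws) ×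
      length ws ≡ k

{-# OPTIONS --safe #-}
-- Write i = 7 + n.  With safety margin 0 a legal state has m = 0, m = i or m = c, so the
-- state graph is two columns joined by the diagonal.  An explicit potential, vanishing at
-- the goal, changes by at most one along every crossing, so every walk needs at least
-- potential(start) = 2i - 3 crossings; along a walk of exactly that length each crossing
-- lowers the potential by one.  Shortest walks are therefore enumerated backwards from the
-- goal, discarding at each state the successors whose potential exceeds the number of
-- crossings left.  Every such walk reaches [i-4,i-4,0] in one of 19 ways, zigzags down the
-- diagonal to [4,4,1] in a unique way, and finishes in one of 19 ways: 19 * 19 = 361.
module Submission where

open import Defs
open import Data.Nat using (ℕ; _≤_)
open import Data.Integer using (+_)

open import Data.Nat using (zero; suc; _+_; _∸_; _<_; _⊓_; _≡ᵇ_; z≤n; s≤s; z<s)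
open import Data.Nat.Properties
import Data.Integer as ℤ
import Data.Integer.Properties as ℤ
open import Data.Bool using (Bool; true; false; if_then_else_; T)
open import Data.Product using (Σ-syntax; _×_; _,_; proj₁; proj₂)
open import Data.Sum using (inj₁; inj₂)
open import Data.Empty using (⊥-elim)
open import Data.List using (List; []; _∷_; length; map; _++_)
open import Data.List.Properties using (length-map; length-++; ∷-injectiveʳ)
open import Data.List.Membership.Propositional using (_∈_)
open import Data.List.Membership.Propositional.Properties using (∈-map⁺; ∈-map⁻; ∈-++⁺ˡ; ∈-++⁺ʳ; ∈-++⁻)
open import Data.List.Relation.Unary.Any using (here; there)
open import Data.List.Relation.Unary.All using ([]; _∷_)
open import Data.List.Relation.Unary.All.Properties using (All¬⇒¬Any)
open import Data.List.Relation.Unary.AllPairs using ([]; _∷_)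
open import Data.List.Relation.Unary.Unique.Propositional using (Unique)
import Data.List.Relation.Unary.Unique.Propositional.Properties as Unique
open import Function using (_∘_)
open import Relation.Nullary using (¬_; Dec; yes; no; _×-dec_)
open import Relation.Nullary.Decidable using (True; toWitness)
open import Relation.Binary using (tri<; tri≈; tri>)
open import Relation.Binary.PropositionalEquality hiding ([_])

Legal′ : ℕ → State → Set
Legal′ n = Legal (7 + n) (7 + n) (+ 0)

Edge′ : ℕ → State → State → Set
Edge′ n = Edge (7 + n) (7 + n) 4 (+ 0)

0≤m-n⇒n≤m : ∀ {m n} → + 0 ℤ.≤ + m ℤ.- + n → n ≤ m
0≤m-n⇒n≤m = ℤ.drop‿+≤+ ∘ ℤ.0≤i-j⇒j≤i

n≤m⇒0≤m-n : ∀ {m n} → n ≤ m → + 0 ℤ.≤ + m ℤ.- + n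
n≤m⇒0≤m-n = ℤ.i≤j⇒0≤j-i ∘ ℤ.+≤+

data Shape (n : ℕ) : State → Set where
  col₀ : ∀ {c} b → c ≤ 7 + n → Shape n [ 0 , c , b ]
  colᵢ : ∀ {c} b → c ≤ 7 + n → Shape n [ 7 + n , c , b ]
  diag : ∀ {k} b → 0 < k → k < 7 + n → Shape n [ k , k , b ]

legal⇒shape : ∀ {n} s → Legal′ n s → Shape n s
legal⇒shape [ zero , c , b ] (_ , c≤i , _) = col₀ b c≤i
legal⇒shape {n} [ suc m , c , b ] (m≤i , c≤i , left , right) with suc m ≟ 7 + n
... | yes refl = colᵢ b c≤i
... | no m≢i with <-cmp c (suc m)
...   | tri≈ _ refl _ = diag b z<s (≤∧≢⇒< m≤i m≢i)
...   | tri> _ _ m<c = ⊥-elim (<⇒≱ m<c (0≤m-n⇒n≤m (left z<s (<-trans z<s m<c))))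
...   | tri< c<m _ _ = ⊥-elim (<⇒≱ (∸-monoʳ-< c<m m≤i) (0≤m-n⇒n≤m (right 0<i-m 0<i-c)))
  where
  m<i = ≤∧≢⇒< m≤i m≢i
  0<i-m = m<n⇒0<n∸m m<i
  0<i-c = m<n⇒0<n∸m (<-trans c<m m<i)

shape⇒legal : ∀ {n s} → Shape n s → Legal′ n s
shape⇒legal {n} (col₀ {c} b c≤i) = z≤n , c≤i , (λ ()) , λ _ _ → n≤m⇒0≤m-n (m∸n≤m (7 + n) c)
shape⇒legal {n} (colᵢ b c≤i) =
  ≤-refl , c≤i , (λ _ _ → n≤m⇒0≤m-n c≤i) , λ i<i _ → ⊥-elim (<-irrefl (sym (n∸n≡0 n)) i<i)
shape⇒legal {n} (diag {k} b _ k<i) =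
  <⇒≤ k<i , <⇒≤ k<i , (λ _ _ → n≤m⇒0≤m-n {k} ≤-refl) , λ _ _ → n≤m⇒0≤m-n {7 + n ∸ k} ≤-refl

-- A crossing back to the first bank is a forward crossing read backwards, so the twelve
-- admissible forward loads describe every edge.
data Crossing : State → State → Set where
  c1 : ∀ {m c} → Crossing [ m , 1 + c , true ] [ m , c , false ]
  c2 : ∀ {m c} → Crossing [ m , 2 + c , true ] [ m , c , false ]
  c3 : ∀ {m c} → Crossing [ m , 3 + c , true ] [ m , c , false ]
  c4 : ∀ {m c} → Crossing [ m , 4 + c , true ] [ m , c , false ]
  m1 : ∀ {m c} → Crossing [ 1 + m , c , true ] [ m , c , false ]
  m2 : ∀ {m c} → Crossing [ 2 + m , c , true ] [ m , c , false ]
  m3 : ∀ {m c} → Crossing [ 3 + m , c , true ] [ m , c , false ]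
  m4 : ∀ {m c} → Crossing [ 4 + m , c , true ] [ m , c , false ]
  m1c1 : ∀ {m c} → Crossing [ 1 + m , 1 + c , true ] [ m , c , false ]
  m2c1 : ∀ {m c} → Crossing [ 2 + m , 1 + c , true ] [ m , c , false ]
  m3c1 : ∀ {m c} → Crossing [ 3 + m , 1 + c , true ] [ m , c , false ]
  m2c2 : ∀ {m c} → Crossing [ 2 + m , 2 + c , true ] [ m , c , false ]

data Step (s t : State) : Set where
  fwd : Crossing s t → Step s t
  bwd : Crossing t s → Step s t

≤-by-computation : ∀ {a b} {p : True (a ≤? b)} → a ≤ b
≤-by-computation {p = p} = toWitness p

shift-≤ : ∀ a b X {p : True (a ≤? b)} → a + X ≤ b + X
shift-≤ a b X {p} = +-monoˡ-≤ X (toWitness p)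

shift-< : ∀ a b X {p : True (a <? b)} → a + X < b + X
shift-< a b X {p} = +-monoˡ-< X (toWitness p)

overloaded : ∀ {k} → ¬ 5 + k ≤ 4
overloaded (s≤s (s≤s (s≤s (s≤s ()))))

load⇒crossing : ∀ {e₁ e₂ m c} → Load 4 (+ 0) e₁ e₂ →
  Crossing [ e₁ + m , e₂ + c , true ] [ m , c , false ]
load⇒crossing {0} {0} (() , _)
load⇒crossing {0} {1} _ = c1
load⇒crossing {0} {2} _ = c2
load⇒crossing {0} {3} _ = c3
load⇒crossing {0} {4} _ = c4
load⇒crossing {0} {suc (suc (suc (suc (suc _))))} (_ , ≤4 , _) = ⊥-elim (overloaded ≤4)
load⇒crossing {1} {0} _ = m1
load⇒crossing {1} {1} _ = m1c1
load⇒crossing {1} {suc (suc _)} (_ , _ , safe) with () ← safe z<s z<s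
load⇒crossing {2} {0} _ = m2
load⇒crossing {2} {1} _ = m2c1
load⇒crossing {2} {2} _ = m2c2
load⇒crossing {2} {suc (suc (suc _))} (_ , ≤4 , _) = ⊥-elim (overloaded ≤4)
load⇒crossing {3} {0} _ = m3
load⇒crossing {3} {1} _ = m3c1
load⇒crossing {3} {suc (suc _)} (_ , ≤4 , _) = ⊥-elim (overloaded ≤4)
load⇒crossing {4} {0} _ = m4
load⇒crossing {4} {suc _} (_ , ≤4 , _) = ⊥-elim (overloaded ≤4)
load⇒crossing {suc (suc (suc (suc (suc _))))} (_ , ≤4 , _) = ⊥-elim (overloaded ≤4)

crossing⇒load : ∀ {s t} → Crossing s t → Σ[ e₁ ∈ ℕ ] Σ[ e₂ ∈ ℕ ]
  Load 4 (+ 0) e₁ e₂ × b s ≡ true × b t ≡ false × m s ≡ e₁ + m t × c s ≡ e₂ + c t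
crossing⇒load c1 = 0 , 1 , (z<s , ≤-by-computation , λ ()) , refl , refl , refl , refl
crossing⇒load c2 = 0 , 2 , (z<s , ≤-by-computation , λ ()) , refl , refl , refl , refl
crossing⇒load c3 = 0 , 3 , (z<s , ≤-by-computation , λ ()) , refl , refl , refl , refl
crossing⇒load c4 = 0 , 4 , (z<s , ≤-by-computation , λ ()) , refl , refl , refl , refl
crossing⇒load m1 = 1 , 0 , (z<s , ≤-by-computation , λ _ ()) , refl , refl , refl , refl
crossing⇒load m2 = 2 , 0 , (z<s , ≤-by-computation , λ _ ()) , refl , refl , refl , refl
crossing⇒load m3 = 3 , 0 , (z<s , ≤-by-computation , λ _ ()) , refl , refl , refl , refl
crossing⇒load m4 = 4 , 0 , (z<s , ≤-by-computation , λ _ ()) , refl , refl , refl , refl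
crossing⇒load m1c1 = 1 , 1 , (z<s , ≤-by-computation , λ _ _ → ℤ.+≤+ z≤n) , refl , refl , refl , refl
crossing⇒load m2c1 = 2 , 1 , (z<s , ≤-by-computation , λ _ _ → ℤ.+≤+ z≤n) , refl , refl , refl , refl
crossing⇒load m3c1 = 3 , 1 , (z<s , ≤-by-computation , λ _ _ → ℤ.+≤+ z≤n) , refl , refl , refl , refl
crossing⇒load m2c2 = 2 , 2 , (z<s , ≤-by-computation , λ _ _ → ℤ.+≤+ z≤n) , refl , refl , refl , refl

edge⇒step : ∀ {n s t} → Edge′ n s t → Step s t
edge⇒step {t = [ m , c , _ ]} (_ , _ , e₁ , e₂ , load , inj₁ (refl , refl , refl , refl))
  rewrite +-comm m e₁ | +-comm c e₂ = fwd (load⇒crossing load)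
edge⇒step {s = [ m , c , _ ]} (_ , _ , e₁ , e₂ , load , inj₂ (refl , refl , refl , refl))
  rewrite +-comm m e₁ | +-comm c e₂ = bwd (load⇒crossing load)

step⇒edge : ∀ {n s t} → Legal′ n s → Legal′ n t → Step s t → Edge′ n s t
step⇒edge ls lt (fwd x) with crossing⇒load x
... | e₁ , e₂ , load , bs , bt , m≡ , c≡ =
  ls , lt , e₁ , e₂ , load , inj₁ (bs , bt , trans m≡ (+-comm e₁ _) , trans c≡ (+-comm e₂ _))
step⇒edge ls lt (bwd x) with crossing⇒load x
... | e₁ , e₂ , load , bt , bs , m≡ , c≡ =
  ls , lt , e₁ , e₂ , load , inj₂ (bs , bt , trans m≡ (+-comm e₁ _) , trans c≡ (+-comm e₂ _))

-- The potential

double : ℕ → ℕ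
double zero = zero
double (suc k) = suc (suc (double k))

-- Lower bounds for the number of crossings to the goal, exact along shortest walks.  The
-- column m = i is indexed by the number of cannibals already on the second bank.
col₀-potential : Bool → ℕ → ℕ
col₀-potential false 0 = 0
col₀-potential false (suc (suc (suc (suc _)))) = 4
col₀-potential false _ = 2
col₀-potential true (suc (suc (suc (suc (suc _))))) = 3
col₀-potential true _ = 1

colᵢ-potential : Bool → ℕ → ℕ
colᵢ-potential true 0 = 4
colᵢ-potential true (suc (suc (suc (suc _)))) = 0
colᵢ-potential true _ = 2
colᵢ-potential false 0 = 5
colᵢ-potential false 1 = 5
colᵢ-potential false (suc (suc (suc (suc (suc _))))) = 1
colᵢ-potential false _ = 3

diag-potential : ℕ → Bool → ℕ → ℕ
diag-potential n false k = double k ⊓ (10 + double n)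
diag-potential n true (suc (suc k)) = suc (double k)
diag-potential n true _ = 1

-- Junk on illegal states: potential-colᵢ and potential-diag are the intended readings.
potential : ℕ → State → ℕ
potential n [ zero , c , b ] = col₀-potential b c
potential n [ suc m , c , b ] =
  if m ≡ᵇ 6 + n then colᵢ-potential b (7 + n ∸ c) + (7 + double n) else diag-potential n b (suc m)

potential-colᵢ : ∀ {n c} b c′ → c′ + c ≡ 7 + n →
  potential n [ 7 + n , c , b ] ≡ colᵢ-potential b c′ + (7 + double n)
potential-colᵢ {n} {c} b c′ c′+c≡i with (6 + n) ≡ᵇ (6 + n) in eq
... | true = cong (λ x → colᵢ-potential b x + (7 + double n)) (begin
  7 + n ∸ c      ≡⟨ cong (_∸ c) c′+c≡i ⟨
  c′ + c ∸ c     ≡⟨ m+n∸n≡m c′ c ⟩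
  c′             ∎)
  where open ≡-Reasoning
... | false with () ← subst T eq (≡⇒≡ᵇ (6 + n) (6 + n) refl)

potential-diag : ∀ {n k} b → 0 < k → k < 7 + n → potential n [ k , k , b ] ≡ diag-potential n b k
potential-diag {n} {suc k} b _ 1+k<i with k ≡ᵇ 6 + n in eq
... | false = refl
... | true = ⊥-elim (<-irrefl (cong suc (≡ᵇ⇒≡ k (6 + n) (subst T (sym eq) _))) 1+k<i)

double-+ : ∀ a n → double (a + n) ≡ double a + double n
double-+ zero n = refl
double-+ (suc a) n = cong (suc ∘ suc) (double-+ a n)

diag-potential-high : ∀ n a → diag-potential n false (a + n) ≡ double a ⊓ 10 + double n
diag-potential-high n a = begin
  double (a + n) ⊓ (10 + double n)       ≡⟨ cong (_⊓ (10 + double n)) (double-+ a n) ⟩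
  (double a + double n) ⊓ (10 + double n) ≡⟨ +-distribʳ-⊓ (double n) (double a) 10 ⟨
  double a ⊓ 10 + double n                ∎
  where open ≡-Reasoning

potential-diag-high : ∀ {n} a → 0 < a + n → a + n < 7 + n →
  potential n [ a + n , a + n , false ] ≡ double a ⊓ 10 + double n
potential-diag-high {n} a 0<k k<i = trans (potential-diag false 0<k k<i) (diag-potential-high n a)

Close : ℕ → ℕ → Set
Close a b = a ≤ suc b × b ≤ suc a

close? : ∀ a b → Dec (Close a b)
close? a b = (a ≤? suc b) ×-dec (b ≤? suc a)

close-by-computation : ∀ {a b} {p : True (close? a b)} → Close a b
close-by-computation {p = p} = toWitness p

close-+ʳ : ∀ {a b} X → Close a b → Close (a + X) (b + X)
close-+ʳ X (p , q) = +-monoˡ-≤ X p , +-monoˡ-≤ X q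

close-offset : ∀ {x y} a b X {p : True (close? a b)} → x ≡ a + X → y ≡ b + X → Close x y
close-offset a b X {p} refl refl = close-+ʳ X (toWitness p)

col₀-close : ∀ e c → 0 < e → e ≤ 4 → Close (col₀-potential true (e + c)) (col₀-potential false c)
col₀-close 0 _ () _
col₀-close 1 0 _ _ = close-by-computation
col₀-close 1 1 _ _ = close-by-computation
col₀-close 1 2 _ _ = close-by-computation
col₀-close 1 3 _ _ = close-by-computation
col₀-close 1 (suc (suc (suc (suc _)))) _ _ = close-by-computation
col₀-close 2 0 _ _ = close-by-computation
col₀-close 2 1 _ _ = close-by-computation
col₀-close 2 2 _ _ = close-by-computation
col₀-close 2 3 _ _ = close-by-computation
col₀-close 2 (suc (suc (suc (suc _)))) _ _ = close-by-computation
col₀-close 3 0 _ _ = close-by-computation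
col₀-close 3 1 _ _ = close-by-computation
col₀-close 3 2 _ _ = close-by-computation
col₀-close 3 3 _ _ = close-by-computation
col₀-close 3 (suc (suc (suc (suc _)))) _ _ = close-by-computation
col₀-close 4 0 _ _ = close-by-computation
col₀-close 4 1 _ _ = close-by-computation
col₀-close 4 2 _ _ = close-by-computation
col₀-close 4 3 _ _ = close-by-computation
col₀-close 4 (suc (suc (suc (suc _)))) _ _ = close-by-computation
col₀-close (suc (suc (suc (suc (suc _))))) _ _ ≤4 = ⊥-elim (overloaded ≤4)

colᵢ-close : ∀ e c → 0 < e → e ≤ 4 → Close (colᵢ-potential true c) (colᵢ-potential false (e + c))
colᵢ-close 0 _ () _
colᵢ-close 1 0 _ _ = close-by-computation
colᵢ-close 1 1 _ _ = close-by-computation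
colᵢ-close 1 2 _ _ = close-by-computation
colᵢ-close 1 3 _ _ = close-by-computation
colᵢ-close 1 (suc (suc (suc (suc _)))) _ _ = close-by-computation
colᵢ-close 2 0 _ _ = close-by-computation
colᵢ-close 2 1 _ _ = close-by-computation
colᵢ-close 2 2 _ _ = close-by-computation
colᵢ-close 2 3 _ _ = close-by-computation
colᵢ-close 2 (suc (suc (suc (suc _)))) _ _ = close-by-computation
colᵢ-close 3 0 _ _ = close-by-computation
colᵢ-close 3 1 _ _ = close-by-computation
colᵢ-close 3 2 _ _ = close-by-computation
colᵢ-close 3 3 _ _ = close-by-computation
colᵢ-close 3 (suc (suc (suc (suc _)))) _ _ = close-by-computation
colᵢ-close 4 0 _ _ = close-by-computation
colᵢ-close 4 1 _ _ = close-by-computation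
colᵢ-close 4 2 _ _ = close-by-computation
colᵢ-close 4 3 _ _ = close-by-computation
colᵢ-close 4 (suc (suc (suc (suc _)))) _ _ = close-by-computation
colᵢ-close (suc (suc (suc (suc (suc _))))) _ _ ≤4 = ⊥-elim (overloaded ≤4)

double-mono-≤ : ∀ {a b} → a ≤ b → double a ≤ double b
double-mono-≤ z≤n = z≤n
double-mono-≤ (s≤s a≤b) = s≤s (s≤s (double-mono-≤ a≤b))

diag-close-m1c1 : ∀ {n k} → 2 + k < 7 + n →
  Close (diag-potential n true (2 + k)) (diag-potential n false (suc k))
diag-close-m1c1 {n} {k} (s≤s (s≤s k<5+n)) =
  s≤s (⊓-glb (≤-trans (n≤1+n _) (n≤1+n _)) (double-mono-≤ (<⇒≤ k<5+n))) ,
  m⊓n≤m _ _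

diag-close-m2c2 : ∀ {n k} → 2 + k < 7 + n →
  Close (diag-potential n true (2 + k)) (diag-potential n false k)
diag-close-m2c2 {n} {k} (s≤s (s≤s k<5+n)) =
  s≤s (⊓-glb ≤-refl (double-mono-≤ (<⇒≤ k<5+n))) ,
  ≤-trans (m⊓n≤m _ _) (≤-trans (n≤1+n _) (n≤1+n _))

colᵢ-close-offset : ∀ {n c} e → 0 < e → e ≤ 4 → e + c ≤ 7 + n →
  Close (potential n [ 7 + n , e + c , true ]) (potential n [ 7 + n , c , false ])
colᵢ-close-offset {n} {c} e 0<e e≤4 e+c≤i =
  subst₂ Close (sym (potential-colᵢ true _ c′+[e+c]≡i)) (sym (potential-colᵢ false _ [e+c′]+c≡i))
    (close-+ʳ (7 + double n) (colᵢ-close e c′ 0<e e≤4))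
  where
  c′ = 7 + n ∸ (e + c)
  c′+[e+c]≡i : c′ + (e + c) ≡ 7 + n
  c′+[e+c]≡i = m∸n+n≡m e+c≤i
  [e+c′]+c≡i : e + c′ + c ≡ 7 + n
  [e+c′]+c≡i = trans (trans (cong (_+ c) (+-comm e c′)) (+-assoc c′ e c)) c′+[e+c]≡i

cannibal-crossing : ∀ {n m c c′ b b′} → Crossing [ m , c , b ] [ m , c′ , b′ ] →
  Shape n [ m , c , b ] → Shape n [ m , c′ , b′ ] →
  Close (potential n [ m , c , b ]) (potential n [ m , c′ , b′ ])
cannibal-crossing _ (colᵢ _ _) (diag _ _ i<i) = ⊥-elim (<-irrefl refl i<i)
cannibal-crossing _ (diag _ _ i<i) (colᵢ _ _) = ⊥-elim (<-irrefl refl i<i)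
cannibal-crossing _ (col₀ _ _) (diag _ () _)
cannibal-crossing c1 (col₀ _ _) (col₀ _ _) = col₀-close 1 _ z<s ≤-by-computation
cannibal-crossing c2 (col₀ _ _) (col₀ _ _) = col₀-close 2 _ z<s ≤-by-computation
cannibal-crossing c3 (col₀ _ _) (col₀ _ _) = col₀-close 3 _ z<s ≤-by-computation
cannibal-crossing c4 (col₀ _ _) (col₀ _ _) = col₀-close 4 _ z<s ≤-by-computation
cannibal-crossing c1 (colᵢ _ e+c≤i) (colᵢ _ _) = colᵢ-close-offset 1 z<s ≤-by-computation e+c≤i
cannibal-crossing c2 (colᵢ _ e+c≤i) (colᵢ _ _) = colᵢ-close-offset 2 z<s ≤-by-computation e+c≤i
cannibal-crossing c3 (colᵢ _ e+c≤i) (colᵢ _ _) = colᵢ-close-offset 3 z<s ≤-by-computation e+c≤i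
cannibal-crossing c4 (colᵢ _ e+c≤i) (colᵢ _ _) = colᵢ-close-offset 4 z<s ≤-by-computation e+c≤i

potential-crossing : ∀ {n s t} → Crossing s t → Shape n s → Shape n t →
  Close (potential n s) (potential n t)
potential-crossing x@c1 σs σt = cannibal-crossing x σs σt
potential-crossing x@c2 σs σt = cannibal-crossing x σs σt
potential-crossing x@c3 σs σt = cannibal-crossing x σs σt
potential-crossing x@c4 σs σt = cannibal-crossing x σs σt
potential-crossing m1 (diag _ _ _) (col₀ _ _) = close-by-computation
potential-crossing m2 (diag _ _ _) (col₀ _ _) = close-by-computation
potential-crossing m3 (diag _ _ _) (col₀ _ _) = close-by-computation
potential-crossing m4 (diag _ _ _) (col₀ _ _) = close-by-computation
potential-crossing m1c1 (diag _ _ _) (col₀ _ _) = close-by-computation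
potential-crossing m2c1 (diag _ _ _) (col₀ _ _) = close-by-computation
potential-crossing m3c1 (diag _ _ _) (col₀ _ _) = close-by-computation
potential-crossing m2c2 (diag _ _ _) (col₀ _ _) = close-by-computation
potential-crossing m1 (diag _ _ k<i) (colᵢ _ _) = ⊥-elim (m+n≮n 1 _ k<i)
potential-crossing m2 (diag _ _ k<i) (colᵢ _ _) = ⊥-elim (m+n≮n 2 _ k<i)
potential-crossing m3 (diag _ _ k<i) (colᵢ _ _) = ⊥-elim (m+n≮n 3 _ k<i)
potential-crossing m4 (diag _ _ k<i) (colᵢ _ _) = ⊥-elim (m+n≮n 4 _ k<i)
potential-crossing m1c1 (diag _ _ k<i) (colᵢ _ _) = ⊥-elim (m+n≮n 1 _ k<i)
potential-crossing m2c1 (diag _ _ k<i) (colᵢ _ _) = ⊥-elim (m+n≮n 2 _ k<i)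
potential-crossing m3c1 (diag _ _ k<i) (colᵢ _ _) = ⊥-elim (m+n≮n 3 _ k<i)
potential-crossing m2c2 (diag _ _ k<i) (colᵢ _ _) = ⊥-elim (m+n≮n 2 _ k<i)
potential-crossing {n} m1 (colᵢ _ _) (diag _ 0<k k<i) =
  close-offset 9 10 (double n) (potential-colᵢ true 1 refl) (potential-diag-high 6 0<k k<i)
potential-crossing {n} m2 (colᵢ _ _) (diag _ 0<k k<i) =
  close-offset 9 10 (double n) (potential-colᵢ true 2 refl) (potential-diag-high 5 0<k k<i)
potential-crossing {n} m3 (colᵢ _ _) (diag _ 0<k k<i) =
  close-offset 9 8 (double n) (potential-colᵢ true 3 refl) (potential-diag-high 4 0<k k<i)
potential-crossing {n} m4 (colᵢ _ _) (diag _ 0<k k<i) =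
  close-offset 7 6 (double n) (potential-colᵢ true 4 refl) (potential-diag-high 3 0<k k<i)
potential-crossing {n} m1c1 (colᵢ _ _) (diag _ 0<k k<i) =
  close-offset 11 10 (double n) (potential-colᵢ true 0 refl) (potential-diag-high 6 0<k k<i)
potential-crossing {n} m2c1 (colᵢ _ _) (diag _ 0<k k<i) =
  close-offset 9 10 (double n) (potential-colᵢ true 1 refl) (potential-diag-high 5 0<k k<i)
potential-crossing {n} m3c1 (colᵢ _ _) (diag _ 0<k k<i) =
  close-offset 9 8 (double n) (potential-colᵢ true 2 refl) (potential-diag-high 4 0<k k<i)
potential-crossing {n} m2c2 (colᵢ _ _) (diag _ 0<k k<i) =
  close-offset 11 10 (double n) (potential-colᵢ true 0 refl) (potential-diag-high 5 0<k k<i)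
potential-crossing m1c1 (diag _ _ 2+k<i) (diag _ 0<k@(s≤s z≤n) k<i) =
  subst₂ Close (sym (potential-diag true z<s 2+k<i)) (sym (potential-diag false 0<k k<i))
    (diag-close-m1c1 2+k<i)
potential-crossing m2c2 (diag _ _ 2+k<i) (diag _ 0<k k<i) =
  subst₂ Close (sym (potential-diag true z<s 2+k<i)) (sym (potential-diag false 0<k k<i))
    (diag-close-m2c2 2+k<i)

potential-step : ∀ {n s t} → Step s t → Shape n s → Shape n t → potential n s ≤ suc (potential n t)
potential-step (fwd x) σs σt = proj₁ (potential-crossing x σs σt)
potential-step (bwd x) σs σt = proj₂ (potential-crossing x σt σs)

source-shape : ∀ {n s t} → Edge′ n s t → Shape n s
source-shape {s = s} e = legal⇒shape s (proj₁ e)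

target-shape : ∀ {n s t} → Edge′ n s t → Shape n t
target-shape {t = t} e = legal⇒shape t (proj₁ (proj₂ e))

walk-length : ∀ {E s t xs} → Walk E s t xs → length xs ≡ suc (crossings xs)
walk-length here = refl
walk-length (there _ _) = refl

potential-bound : ∀ {n s t xs} → Walk (Edge′ n) s t xs → potential n s ≤ crossings xs + potential n t
potential-bound here = ≤-refl
potential-bound {n} {s} {t} (there {u = u} {xs = xs} e w) = begin
  potential n s                       ≤⟨ potential-step (edge⇒step e) (source-shape e) (target-shape e) ⟩
  suc (potential n u)                 ≤⟨ s≤s (potential-bound w) ⟩
  suc (crossings xs + potential n t)  ≡⟨ cong (_+ potential n t) (walk-length w) ⟨
  length xs + potential n t           ∎
  where open ≤-Reasoning

Reach : ℕ → State → ℕ → Set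
Reach n s r = Σ[ xs ∈ List State ] Walk (Edge′ n) s goal xs × crossings xs ≡ r

reach-bound : ∀ {n s r} → Reach n s r → potential n s ≤ r
reach-bound {n} {s} (xs , w , refl) =
  subst (potential n s ≤_) (+-identityʳ (crossings xs)) (potential-bound w)

too-far : ∀ {n s r} → r < potential n s → ¬ Reach n s r
too-far r<p ρ = <⇒≱ r<p (reach-bound ρ)

too-far-colᵢ : ∀ {n c} b c′ a → c′ + c ≡ 7 + n → {p : True (a <? colᵢ-potential b c′ + 7)} →
  ¬ Reach n [ 7 + n , c , b ] (a + double n)
too-far-colᵢ {n} {c} b c′ a c′+c≡i {p} = too-far (begin-strict
  a + double n                          <⟨ +-monoˡ-< (double n) (toWitness p) ⟩
  colᵢ-potential b c′ + 7 + double n    ≡⟨ +-assoc (colᵢ-potential b c′) 7 (double n) ⟩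
  colᵢ-potential b c′ + (7 + double n)  ≡⟨ potential-colᵢ b c′ c′+c≡i ⟨
  potential n [ 7 + n , c , b ]         ∎)
  where open ≤-Reasoning

too-far-diag : ∀ {n k b r} → 0 < k → k < 7 + n → r < diag-potential n b k → ¬ Reach n [ k , k , b ] r
too-far-diag {b = b} 0<k k<i r<p = too-far (subst (_ <_) (sym (potential-diag b 0<k k<i)) r<p)

too-far-diag-high : ∀ {n} a r → 0 < a + n → a + n < 7 + n → {p : True (r <? double a ⊓ 10)} →
  ¬ Reach n [ a + n , a + n , false ] (r + double n)
too-far-diag-high {n} a r 0<k k<i {p} =
  too-far-diag 0<k k<i
    (subst (r + double n <_) (sym (diag-potential-high n a)) (+-monoˡ-< (double n) (toWitness p)))

-- Enumerating shortest walks backwards from the goal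

crossings-tail : ∀ {E s t xs r} → Walk E s t xs → length xs ≡ suc r → crossings xs ≡ r
crossings-tail w eq = suc-injective (trans (sym (walk-length w)) eq)

dead-end : ∀ {n s r} → (∀ {t} → Step s t → Shape n t → ¬ Reach n t r) → ¬ Reach n s (suc r)
dead-end none (_ , there e w , eq) = none (edge⇒step e) (target-shape e) (_ , w , crossings-tail w eq)

walk-source-unique : ∀ {E E′ s s′ t t′ xs} → Walk E s t xs → Walk E′ s′ t′ xs → s ≡ s′
walk-source-unique here here = refl
walk-source-unique here (there _ _) = refl
walk-source-unique (there _ _) here = refl
walk-source-unique (there _ _) (there _ _) = refl

record Solutions (n : ℕ) (s : State) (r k : ℕ) : Set where
  field
    shape    : Shape n s
    walks    : List (List State)
    count    : length walks ≡ k
    distinct : Unique walks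
    sound    : ∀ {xs} → xs ∈ walks → Walk (Edge′ n) s goal xs × crossings xs ≡ r
    complete : ∀ {xs} → Walk (Edge′ n) s goal xs → crossings xs ≡ r → xs ∈ walks
open Solutions

infixr 5 _⇒_∷_
data Branches (n : ℕ) (s : State) (r : ℕ) : List State → ℕ → Set where
  []    : Branches n s r [] 0
  _⇒_∷_ : ∀ {t k ts k′} → Step s t → Solutions n t r k → Branches n s r ts k′ →
          Branches n s r (t ∷ ts) (k + k′)

module _ {n : ℕ} {s : State} {r : ℕ} where

  tails : ∀ {ts k} → Branches n s r ts k → List (List State)
  tails [] = []
  tails (_ ⇒ S ∷ bs) = walks S ++ tails bs

  tails-count : ∀ {ts k} (bs : Branches n s r ts k) → length (tails bs) ≡ k
  tails-count [] = refl
  tails-count (_ ⇒ S ∷ bs) = trans (length-++ (walks S)) (cong₂ _+_ (count S) (tails-count bs))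

  tails-sound : ∀ {ts k xs} (bs : Branches n s r ts k) → xs ∈ tails bs →
    Σ[ t ∈ State ] t ∈ ts × Step s t × Shape n t × Walk (Edge′ n) t goal xs × crossings xs ≡ r
  tails-sound (step ⇒ S ∷ bs) xs∈ with ∈-++⁻ (walks S) xs∈
  ... | inj₁ xs∈S = _ , here refl , step , shape S , sound S xs∈S
  ... | inj₂ xs∈bs with tails-sound bs xs∈bs
  ...   | t , t∈ts , rest = t , there t∈ts , rest

  tails-distinct : ∀ {ts k} (bs : Branches n s r ts k) → Unique ts → Unique (tails bs)
  tails-distinct [] _ = []
  tails-distinct (_ ⇒ S ∷ bs) (t∉ts ∷ ts-distinct) =
    Unique.++⁺ (distinct S) (tails-distinct bs ts-distinct) λ (xs∈S , xs∈bs) →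
      let t′ , t′∈ts , _ , _ , w′ , _ = tails-sound bs xs∈bs
      in All¬⇒¬Any t∉ts (subst (_∈ _) (sym (walk-source-unique (proj₁ (sound S xs∈S)) w′)) t′∈ts)

  tails-complete : ∀ {ts k t xs} (bs : Branches n s r ts k) → t ∈ ts →
    Walk (Edge′ n) t goal xs → crossings xs ≡ r → xs ∈ tails bs
  tails-complete (_ ⇒ S ∷ bs) (here refl) w eq = ∈-++⁺ˡ (complete S w eq)
  tails-complete (_ ⇒ S ∷ bs) (there t∈ts) w eq = ∈-++⁺ʳ (walks S) (tails-complete bs t∈ts w eq)

  extend-sound : ∀ {ts k xs} → Shape n s → (bs : Branches n s r ts k) → xs ∈ map (s ∷_) (tails bs) →
    Walk (Edge′ n) s goal xs × crossings xs ≡ suc r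
  extend-sound σ bs xs∈ with ∈-map⁻ (s ∷_) xs∈
  ... | _ , ys∈ , refl with tails-sound bs ys∈
  ...   | _ , _ , step , σt , w , eq =
    there (step⇒edge (shape⇒legal σ) (shape⇒legal σt) step) w , trans (walk-length w) (cong suc eq)

  extend : ∀ {ts k} → Shape n s → (bs : Branches n s r ts k) → Unique ts →
    (∀ {t} → Step s t → Shape n t → Reach n t r → t ∈ ts) → Solutions n s (suc r) k
  extend σ bs ts-distinct covers = record
    { shape    = σ
    ; walks    = map (s ∷_) (tails bs)
    ; count    = trans (length-map (s ∷_) (tails bs)) (tails-count bs)
    ; distinct = Unique.map⁺ ∷-injectiveʳ (tails-distinct bs ts-distinct)
    ; sound    = extend-sound σ bs
    ; complete = λ where
        (there e w) eq → let eq′ = crossings-tail w eq in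
          ∈-map⁺ (s ∷_) (tails-complete bs (covers (edge⇒step e) (target-shape e) (_ , w , eq′)) w eq′)
    }

solutions-goal : ∀ {n} → Solutions n goal 0 1
solutions-goal = record
  { shape    = col₀ false z≤n
  ; walks    = (goal ∷ []) ∷ []
  ; count    = refl
  ; distinct = [] ∷ []
  ; sound    = λ { (here refl) → here , refl }
  ; complete = λ where
      here _ → here refl
      (there _ w) eq → ⊥-elim (0≢1+n (trans (sym eq) (walk-length w)))
  }

-- Shortest walks near the goal

solutions[0,4,1] : ∀ {n} → Solutions n [ 0 , 4 , true ] 1 1
solutions[0,4,1] = extend (col₀ true ≤-by-computation)
  (fwd c4 ⇒ solutions-goal ∷ [])
  ([] ∷ []) λ where
    (fwd c1) (col₀ _ _) ρ → ⊥-elim (too-far ≤-by-computation ρ)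
    (fwd c2) (col₀ _ _) ρ → ⊥-elim (too-far ≤-by-computation ρ)
    (fwd c3) (col₀ _ _) ρ → ⊥-elim (too-far ≤-by-computation ρ)
    (fwd c4) (col₀ _ _) _ → here refl

solutions[0,3,1] : ∀ {n} → Solutions n [ 0 , 3 , true ] 1 1
solutions[0,3,1] = extend (col₀ true ≤-by-computation)
  (fwd c3 ⇒ solutions-goal ∷ [])
  ([] ∷ []) λ where
    (fwd c1) (col₀ _ _) ρ → ⊥-elim (too-far ≤-by-computation ρ)
    (fwd c2) (col₀ _ _) ρ → ⊥-elim (too-far ≤-by-computation ρ)
    (fwd c3) (col₀ _ _) _ → here refl

solutions[2,2,1] : ∀ {n} → Solutions n [ 2 , 2 , true ] 1 1
solutions[2,2,1] = extend (diag true z<s ≤-by-computation)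
  (fwd m2c2 ⇒ solutions-goal ∷ [])
  ([] ∷ []) λ where
    (fwd m2) (col₀ _ _) ρ → ⊥-elim (too-far ≤-by-computation ρ)
    (fwd m1c1) (diag _ _ _) ρ → ⊥-elim (too-far ≤-by-computation ρ)
    (fwd m2c1) (col₀ _ _) ρ → ⊥-elim (too-far ≤-by-computation ρ)
    (fwd m2c2) (col₀ _ _) _ → here refl

solutions[0,2,1] : ∀ {n} → Solutions n [ 0 , 2 , true ] 1 1
solutions[0,2,1] = extend (col₀ true ≤-by-computation)
  (fwd c2 ⇒ solutions-goal ∷ [])
  ([] ∷ []) λ where
    (fwd c1) (col₀ _ _) ρ → ⊥-elim (too-far ≤-by-computation ρ)
    (fwd c2) (col₀ _ _) _ → here refl

solutions[1,1,1] : ∀ {n} → Solutions n [ 1 , 1 , true ] 1 1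
solutions[1,1,1] = extend (diag true z<s ≤-by-computation)
  (fwd m1c1 ⇒ solutions-goal ∷ [])
  ([] ∷ []) λ where
    (fwd m1) (col₀ _ _) ρ → ⊥-elim (too-far ≤-by-computation ρ)
    (fwd m1c1) (col₀ _ _) _ → here refl

solutions[0,3,0] : ∀ {n} → Solutions n [ 0 , 3 , false ] 2 1
solutions[0,3,0] = extend (col₀ false ≤-by-computation)
  (bwd c1 ⇒ solutions[0,4,1] ∷ [])
  ([] ∷ []) λ where
    (bwd c1) (col₀ _ _) _ → here refl
    (bwd c2) (col₀ _ _) ρ → ⊥-elim (too-far ≤-by-computation ρ)
    (bwd c3) (col₀ _ _) ρ → ⊥-elim (too-far ≤-by-computation ρ)
    (bwd c4) (col₀ _ _) ρ → ⊥-elim (too-far ≤-by-computation ρ)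
    (bwd m3) (diag _ _ _) ρ → ⊥-elim (too-far ≤-by-computation ρ)

solutions[0,2,0] : ∀ {n} → Solutions n [ 0 , 2 , false ] 2 3
solutions[0,2,0] = extend (col₀ false ≤-by-computation)
  (bwd c1 ⇒ solutions[0,3,1] ∷ bwd c2 ⇒ solutions[0,4,1] ∷ bwd m2 ⇒ solutions[2,2,1] ∷ [])
  (((λ ()) ∷ (λ ()) ∷ []) ∷ ((λ ()) ∷ []) ∷ [] ∷ []) λ where
    (bwd c1) (col₀ _ _) _ → here refl
    (bwd c2) (col₀ _ _) _ → there (here refl)
    (bwd c3) (col₀ _ _) ρ → ⊥-elim (too-far ≤-by-computation ρ)
    (bwd c4) (col₀ _ _) ρ → ⊥-elim (too-far ≤-by-computation ρ)
    (bwd m2) (diag _ _ _) _ → there (there (here refl))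
    (bwd m3c1) (diag _ _ _) ρ → ⊥-elim (too-far ≤-by-computation ρ)

solutions[0,1,0] : ∀ {n} → Solutions n [ 0 , 1 , false ] 2 5
solutions[0,1,0] = extend (col₀ false ≤-by-computation)
  ( bwd c1 ⇒ solutions[0,2,1]
  ∷ bwd c2 ⇒ solutions[0,3,1]
  ∷ bwd c3 ⇒ solutions[0,4,1]
  ∷ bwd m1 ⇒ solutions[1,1,1]
  ∷ bwd m2c1 ⇒ solutions[2,2,1]
  ∷ [])
  ( ((λ ()) ∷ (λ ()) ∷ (λ ()) ∷ (λ ()) ∷ [])
  ∷ ((λ ()) ∷ (λ ()) ∷ (λ ()) ∷ [])
  ∷ ((λ ()) ∷ (λ ()) ∷ [])
  ∷ ((λ ()) ∷ [])
  ∷ [] ∷ []) λ where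
    (bwd c1) (col₀ _ _) _ → here refl
    (bwd c2) (col₀ _ _) _ → there (here refl)
    (bwd c3) (col₀ _ _) _ → there (there (here refl))
    (bwd c4) (col₀ _ _) ρ → ⊥-elim (too-far ≤-by-computation ρ)
    (bwd m1) (diag _ _ _) _ → there (there (there (here refl)))
    (bwd m2c1) (diag _ _ _) _ → there (there (there (there (here refl))))

solutions[1,1,0] : ∀ {n} → Solutions n [ 1 , 1 , false ] 2 1
solutions[1,1,0] = extend (diag false z<s ≤-by-computation)
  (bwd m1c1 ⇒ solutions[2,2,1] ∷ [])
  ([] ∷ []) λ where
    (bwd m1c1) (diag _ _ _) _ → here refl
    (bwd m2c2) (diag _ _ _) ρ → ⊥-elim (too-far ≤-by-computation ρ)

solutions[0,5,1] : ∀ {n} → Solutions n [ 0 , 5 , true ] 3 9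
solutions[0,5,1] = extend (col₀ true ≤-by-computation)
  (fwd c2 ⇒ solutions[0,3,0] ∷ fwd c3 ⇒ solutions[0,2,0] ∷ fwd c4 ⇒ solutions[0,1,0] ∷ [])
  (((λ ()) ∷ (λ ()) ∷ []) ∷ ((λ ()) ∷ []) ∷ [] ∷ []) λ where
    (fwd c1) (col₀ _ _) ρ → ⊥-elim (too-far ≤-by-computation ρ)
    (fwd c2) (col₀ _ _) _ → here refl
    (fwd c3) (col₀ _ _) _ → there (here refl)
    (fwd c4) (col₀ _ _) _ → there (there (here refl))

solutions[0,6,1] : ∀ {n} → Solutions n [ 0 , 6 , true ] 3 4
solutions[0,6,1] = extend (col₀ true ≤-by-computation)
  (fwd c3 ⇒ solutions[0,3,0] ∷ fwd c4 ⇒ solutions[0,2,0] ∷ [])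
  (((λ ()) ∷ []) ∷ [] ∷ []) λ where
    (fwd c1) (col₀ _ _) ρ → ⊥-elim (too-far ≤-by-computation ρ)
    (fwd c2) (col₀ _ _) ρ → ⊥-elim (too-far ≤-by-computation ρ)
    (fwd c3) (col₀ _ _) _ → here refl
    (fwd c4) (col₀ _ _) _ → there (here refl)

solutions[0,7,1] : ∀ {n} → Solutions n [ 0 , 7 , true ] 3 1
solutions[0,7,1] = extend (col₀ true ≤-by-computation)
  (fwd c4 ⇒ solutions[0,3,0] ∷ [])
  ([] ∷ []) λ where
    (fwd c1) (col₀ _ _) ρ → ⊥-elim (too-far ≤-by-computation ρ)
    (fwd c2) (col₀ _ _) ρ → ⊥-elim (too-far ≤-by-computation ρ)
    (fwd c3) (col₀ _ _) ρ → ⊥-elim (too-far ≤-by-computation ρ)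
    (fwd c4) (col₀ _ _) _ → here refl

no-walk[0,8,1] : ∀ {n} → ¬ Reach n [ 0 , 8 , true ] 3
no-walk[0,8,1] = dead-end λ where
  (fwd c1) (col₀ _ _) ρ → too-far ≤-by-computation ρ
  (fwd c2) (col₀ _ _) ρ → too-far ≤-by-computation ρ
  (fwd c3) (col₀ _ _) ρ → too-far ≤-by-computation ρ
  (fwd c4) (col₀ _ _) ρ → too-far ≤-by-computation ρ

solutions[3,3,1] : ∀ {n} → Solutions n [ 3 , 3 , true ] 3 5
solutions[3,3,1] = extend (diag true z<s ≤-by-computation)
  (fwd m3 ⇒ solutions[0,3,0] ∷ fwd m3c1 ⇒ solutions[0,2,0] ∷ fwd m2c2 ⇒ solutions[1,1,0] ∷ [])
  (((λ ()) ∷ (λ ()) ∷ []) ∷ ((λ ()) ∷ []) ∷ [] ∷ []) λ where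
    (fwd m3) (col₀ _ _) _ → here refl
    (fwd m1c1) (diag _ _ _) ρ → ⊥-elim (too-far ≤-by-computation ρ)
    (fwd m3c1) (col₀ _ _) _ → there (here refl)
    (fwd m2c2) (diag _ _ _) _ → there (there (here refl))

solutions[0,4,0] : ∀ {n} → Solutions n [ 0 , 4 , false ] 4 14
solutions[0,4,0] = extend (col₀ false ≤-by-computation)
  (bwd c1 ⇒ solutions[0,5,1] ∷ bwd c2 ⇒ solutions[0,6,1] ∷ bwd c3 ⇒ solutions[0,7,1] ∷ [])
  (((λ ()) ∷ (λ ()) ∷ []) ∷ ((λ ()) ∷ []) ∷ [] ∷ []) λ where
    (bwd c1) (col₀ _ _) _ → here refl
    (bwd c2) (col₀ _ _) _ → there (here refl)
    (bwd c3) (col₀ _ _) _ → there (there (here refl))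
    (bwd c4) (col₀ _ _) ρ → ⊥-elim (no-walk[0,8,1] ρ)
    (bwd m4) (diag _ _ _) ρ → ⊥-elim (too-far ≤-by-computation ρ)

solutions[2,2,0] : ∀ {n} → Solutions n [ 2 , 2 , false ] 4 5
solutions[2,2,0] = extend (diag false z<s ≤-by-computation)
  (bwd m1c1 ⇒ solutions[3,3,1] ∷ [])
  ([] ∷ []) λ where
    (bwd m1c1) (diag _ _ _) _ → here refl
    (bwd m2c2) (diag _ _ _) ρ → ⊥-elim (too-far ≤-by-computation ρ)

solutions[4,4,1] : ∀ {n} → Solutions n [ 4 , 4 , true ] 5 19
solutions[4,4,1] = extend (diag true z<s ≤-by-computation)
  (fwd m4 ⇒ solutions[0,4,0] ∷ fwd m2c2 ⇒ solutions[2,2,0] ∷ [])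
  (((λ ()) ∷ []) ∷ [] ∷ []) λ where
    (fwd m4) (col₀ _ _) _ → here refl
    (fwd m1c1) (diag _ _ _) ρ → ⊥-elim (too-far ≤-by-computation ρ)
    (fwd m2c2) (diag _ _ _) _ → there (here refl)

-- The diagonal

mutual
  solutions[3+p,3+p,0] : ∀ {n} p → p ≤ n → Solutions n [ 3 + p , 3 + p , false ] (6 + double p) 19
  solutions[3+p,3+p,0] {n} p p≤n =
    extend (diag false z<s (+-mono-<-≤ (≤-by-computation {4} {7}) p≤n))
    (bwd m1c1 ⇒ solutions[4+p,4+p,1] p p≤n ∷ [])
    ([] ∷ []) λ where
      (bwd c1) (colᵢ _ _) _ → ⊥-elim (m+n≮n 3 n p≤n)
      (bwd c2) (colᵢ _ _) _ → ⊥-elim (m+n≮n 3 n p≤n)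
      (bwd c3) (colᵢ _ _) _ → ⊥-elim (m+n≮n 3 n p≤n)
      (bwd c4) (colᵢ _ _) _ → ⊥-elim (m+n≮n 3 n p≤n)
      (bwd m1) (colᵢ _ _) _ → ⊥-elim (m+n≮n 2 n p≤n)
      (bwd m2) (colᵢ _ _) _ → ⊥-elim (m+n≮n 1 n p≤n)
      (bwd m3) (colᵢ _ _) _ → ⊥-elim (m+n≮n 0 n p≤n)
      (bwd m4) (colᵢ _ _) ρ → ⊥-elim (too-far-colᵢ true 4 5 refl ρ)
      (bwd m1c1) (colᵢ _ _) _ → ⊥-elim (m+n≮n 2 n p≤n)
      (bwd m1c1) (diag _ _ _) _ → here refl
      (bwd m2c1) (colᵢ _ _) _ → ⊥-elim (m+n≮n 1 n p≤n)
      (bwd m3c1) (colᵢ _ _) _ → ⊥-elim (m+n≮n 0 n p≤n)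
      (bwd m2c2) (colᵢ _ _) _ → ⊥-elim (m+n≮n 1 n p≤n)
      (bwd m2c2) (diag _ 0<k k<i) ρ → ⊥-elim (too-far-diag 0<k k<i (shift-< 5 7 (double p)) ρ)

  solutions[4+p,4+p,1] : ∀ {n} p → p ≤ n → Solutions n [ 4 + p , 4 + p , true ] (5 + double p) 19
  solutions[4+p,4+p,1] zero _ = solutions[4,4,1]
  solutions[4+p,4+p,1] {n} (suc p) 1+p≤n =
    extend (diag true z<s (+-mono-<-≤ (≤-by-computation {5} {7}) 1+p≤n))
    (fwd m2c2 ⇒ solutions[3+p,3+p,0] p (≤-trans (n≤1+n p) 1+p≤n) ∷ [])
    ([] ∷ []) λ where
      (fwd c1) (colᵢ _ _) _ → ⊥-elim (m+n≮n 2 n 1+p≤n)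
      (fwd c2) (colᵢ _ _) _ → ⊥-elim (m+n≮n 2 n 1+p≤n)
      (fwd c3) (colᵢ _ _) _ → ⊥-elim (m+n≮n 2 n 1+p≤n)
      (fwd c4) (colᵢ _ _) _ → ⊥-elim (m+n≮n 2 n 1+p≤n)
      (fwd m1) (colᵢ _ _) _ → ⊥-elim (m+n≮n 3 n 1+p≤n)
      (fwd m2) (colᵢ _ _) _ → ⊥-elim (m+n≮n 4 n 1+p≤n)
      (fwd m3) (colᵢ _ _) _ → ⊥-elim (m+n≮n 5 n 1+p≤n)
      (fwd m4) (colᵢ _ _) _ → ⊥-elim (m+n≮n 6 n 1+p≤n)
      (fwd m1c1) (colᵢ _ _) _ → ⊥-elim (m+n≮n 3 n 1+p≤n)
      (fwd m1c1) (diag _ 0<k k<i) ρ → ⊥-elim (too-far-diag 0<k k<i (⊓-glb (n≤1+n _) 7+2p≤10+2n) ρ)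
      (fwd m2c1) (colᵢ _ _) _ → ⊥-elim (m+n≮n 4 n 1+p≤n)
      (fwd m3c1) (colᵢ _ _) _ → ⊥-elim (m+n≮n 5 n 1+p≤n)
      (fwd m2c2) (colᵢ _ _) _ → ⊥-elim (m+n≮n 4 n 1+p≤n)
      (fwd m2c2) (diag _ _ _) _ → here refl
    where
    7+2p≤10+2n : 7 + double p ≤ 10 + double n
    7+2p≤10+2n = ≤-trans (+-monoʳ-≤ 5 (double-mono-≤ 1+p≤n)) (shift-≤ 5 10 (double n))

-- Shortest walks near the start

solutions[7+n,3+n,1] : ∀ {n} → Solutions n [ 7 + n , 3 + n , true ] (7 + double n) 19
solutions[7+n,3+n,1] {n} = extend (colᵢ true (shift-≤ 3 7 n))
  (fwd m4 ⇒ solutions[3+p,3+p,0] n ≤-refl ∷ [])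
  ([] ∷ []) covers
  where
  -- n is bound locally: matching c4 forces 4 + c ≡ 3 + n, which instantiates n.
  covers : ∀ {n t} → Step [ 7 + n , 3 + n , true ] t → Shape n t → Reach n t (6 + double n) →
    t ∈ [ 3 + n , 3 + n , false ] ∷ []
  covers (fwd c1) (colᵢ _ _) ρ = ⊥-elim (too-far-colᵢ false 5 6 refl ρ)
  covers (fwd c2) (colᵢ _ _) ρ = ⊥-elim (too-far-colᵢ false 6 6 refl ρ)
  covers (fwd c3) (colᵢ _ _) ρ = ⊥-elim (too-far-colᵢ false 7 6 refl ρ)
  covers (fwd c4) (colᵢ _ _) ρ = ⊥-elim (too-far-colᵢ false 8 6 refl ρ)
  covers (fwd m4) (diag _ _ _) _ = here refl

no-walk[7+n,2+n,1] : ∀ {n} → ¬ Reach n [ 7 + n , 2 + n , true ] (7 + double n)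
no-walk[7+n,2+n,1] = dead-end never
  where
  never : ∀ {n t} → Step [ 7 + n , 2 + n , true ] t → Shape n t → ¬ Reach n t (6 + double n)
  never (fwd c1) (colᵢ _ _) ρ = too-far-colᵢ false 6 6 refl ρ
  never (fwd c2) (colᵢ _ _) ρ = too-far-colᵢ false 7 6 refl ρ
  never (fwd c3) (colᵢ _ _) ρ = too-far-colᵢ false 8 6 refl ρ
  never (fwd c4) (colᵢ _ _) ρ = too-far-colᵢ false 9 6 refl ρ

solutions[5+n,5+n,1] : ∀ {n} → Solutions n [ 5 + n , 5 + n , true ] (7 + double n) 19
solutions[5+n,5+n,1] {n} = extend (diag true z<s (shift-< 5 7 n))
  (fwd m2c2 ⇒ solutions[3+p,3+p,0] n ≤-refl ∷ [])
  ([] ∷ []) λ where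
    (fwd m1c1) (diag _ 0<k k<i) ρ → ⊥-elim (too-far-diag-high 4 6 0<k k<i ρ)
    (fwd m2c2) (diag _ _ _) _ → here refl

no-walk[7+n,1+n,1] : ∀ {n} → ¬ Reach n [ 7 + n , 1 + n , true ] (7 + double n)
no-walk[7+n,1+n,1] = dead-end never
  where
  never : ∀ {n t} → Step [ 7 + n , 1 + n , true ] t → Shape n t → ¬ Reach n t (6 + double n)
  never (fwd c1) (colᵢ _ _) ρ = too-far-colᵢ false 7 6 refl ρ
  never (fwd c2) (colᵢ _ _) ρ = too-far-colᵢ false 8 6 refl ρ
  never (fwd c3) (colᵢ _ _) ρ = too-far-colᵢ false 9 6 refl ρ
  never (fwd c4) (colᵢ _ _) ρ = too-far-colᵢ false 10 6 refl ρ

solutions[7+n,2+n,0] : ∀ {n} → Solutions n [ 7 + n , 2 + n , false ] (8 + double n) 19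
solutions[7+n,2+n,0] {n} = extend (colᵢ false (shift-≤ 2 7 n))
  (bwd c1 ⇒ solutions[7+n,3+n,1] ∷ [])
  ([] ∷ []) λ where
    (bwd c1) (colᵢ _ _) _ → here refl
    (bwd c2) (colᵢ _ _) ρ → ⊥-elim (too-far-colᵢ true 3 7 refl ρ)
    (bwd c3) (colᵢ _ _) ρ → ⊥-elim (too-far-colᵢ true 2 7 refl ρ)
    (bwd c4) (colᵢ _ _) ρ → ⊥-elim (too-far-colᵢ true 1 7 refl ρ)

solutions[7+n,1+n,0] : ∀ {n} → Solutions n [ 7 + n , 1 + n , false ] (8 + double n) 19
solutions[7+n,1+n,0] {n} = extend (colᵢ false (shift-≤ 1 7 n))
  (bwd c2 ⇒ solutions[7+n,3+n,1] ∷ [])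
  ([] ∷ []) λ where
    (bwd c1) (colᵢ _ _) ρ → ⊥-elim (no-walk[7+n,2+n,1] ρ)
    (bwd c2) (colᵢ _ _) _ → here refl
    (bwd c3) (colᵢ _ _) ρ → ⊥-elim (too-far-colᵢ true 3 7 refl ρ)
    (bwd c4) (colᵢ _ _) ρ → ⊥-elim (too-far-colᵢ true 2 7 refl ρ)

solutions[4+n,4+n,0] : ∀ {n} → Solutions n [ 4 + n , 4 + n , false ] (8 + double n) 19
solutions[4+n,4+n,0] {n} = extend (diag false z<s (shift-< 4 7 n))
  (bwd m1c1 ⇒ solutions[5+n,5+n,1] ∷ [])
  ([] ∷ []) λ where
    (bwd m3) (colᵢ _ _) ρ → ⊥-elim (too-far-colᵢ true 3 7 refl ρ)
    (bwd m1c1) (diag _ _ _) _ → here refl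
    (bwd m3c1) (colᵢ _ _) ρ → ⊥-elim (too-far-colᵢ true 2 7 refl ρ)
    (bwd m2c2) (diag _ 0<k k<i) ρ → ⊥-elim (too-far-diag 0<k k<i (shift-< 7 9 (double n)) ρ)

solutions[7+n,n,0] : ∀ {n} → Solutions n [ 7 + n , n , false ] (8 + double n) 19
solutions[7+n,n,0] {n} = extend (colᵢ false (m≤n+m n 7))
  (bwd c3 ⇒ solutions[7+n,3+n,1] ∷ [])
  ([] ∷ []) λ where
    (bwd c1) (colᵢ _ _) ρ → ⊥-elim (no-walk[7+n,1+n,1] ρ)
    (bwd c2) (colᵢ _ _) ρ → ⊥-elim (no-walk[7+n,2+n,1] ρ)
    (bwd c3) (colᵢ _ _) _ → here refl
    (bwd c4) (colᵢ _ _) ρ → ⊥-elim (too-far-colᵢ true 3 7 refl ρ)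

solutions[7+n,6+n,1] : ∀ {n} → Solutions n [ 7 + n , 6 + n , true ] (9 + double n) 19
solutions[7+n,6+n,1] {n} = extend (colᵢ true (shift-≤ 6 7 n))
  (fwd c4 ⇒ solutions[7+n,2+n,0] ∷ [])
  ([] ∷ []) λ where
    (fwd c1) (colᵢ _ _) ρ → ⊥-elim (too-far-colᵢ false 2 8 refl ρ)
    (fwd c2) (colᵢ _ _) ρ → ⊥-elim (too-far-colᵢ false 3 8 refl ρ)
    (fwd c3) (colᵢ _ _) ρ → ⊥-elim (too-far-colᵢ false 4 8 refl ρ)
    (fwd c4) (colᵢ _ _) _ → here refl
    (fwd m1) (diag _ 0<k k<i) ρ → ⊥-elim (too-far-diag-high 6 8 0<k k<i ρ)
    (fwd m2c1) (diag _ 0<k k<i) ρ → ⊥-elim (too-far-diag-high 5 8 0<k k<i ρ)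

solutions[7+n,5+n,1] : ∀ {n} → Solutions n [ 7 + n , 5 + n , true ] (9 + double n) 57
solutions[7+n,5+n,1] {n} = extend (colᵢ true (shift-≤ 5 7 n))
  ( fwd c3 ⇒ solutions[7+n,2+n,0]
  ∷ fwd c4 ⇒ solutions[7+n,1+n,0]
  ∷ fwd m3c1 ⇒ solutions[4+n,4+n,0]
  ∷ [])
  (((λ ()) ∷ (λ ()) ∷ []) ∷ ((λ ()) ∷ []) ∷ [] ∷ []) λ where
    (fwd c1) (colᵢ _ _) ρ → ⊥-elim (too-far-colᵢ false 3 8 refl ρ)
    (fwd c2) (colᵢ _ _) ρ → ⊥-elim (too-far-colᵢ false 4 8 refl ρ)
    (fwd c3) (colᵢ _ _) _ → here refl
    (fwd c4) (colᵢ _ _) _ → there (here refl)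
    (fwd m2) (diag _ 0<k k<i) ρ → ⊥-elim (too-far-diag-high 5 8 0<k k<i ρ)
    (fwd m3c1) (diag _ _ _) _ → there (there (here refl))

solutions[7+n,4+n,1] : ∀ {n} → Solutions n [ 7 + n , 4 + n , true ] (9 + double n) 76
solutions[7+n,4+n,1] {n} = extend (colᵢ true (shift-≤ 4 7 n))
  ( fwd c2 ⇒ solutions[7+n,2+n,0]
  ∷ fwd c3 ⇒ solutions[7+n,1+n,0]
  ∷ fwd c4 ⇒ solutions[7+n,n,0]
  ∷ fwd m3 ⇒ solutions[4+n,4+n,0]
  ∷ [])
  ( ((λ ()) ∷ (λ ()) ∷ (λ ()) ∷ [])
  ∷ ((λ ()) ∷ (λ ()) ∷ [])
  ∷ ((λ ()) ∷ [])
  ∷ [] ∷ []) λ where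
    (fwd c1) (colᵢ _ _) ρ → ⊥-elim (too-far-colᵢ false 4 8 refl ρ)
    (fwd c2) (colᵢ _ _) _ → here refl
    (fwd c3) (colᵢ _ _) _ → there (here refl)
    (fwd c4) (colᵢ _ _) _ → there (there (here refl))
    (fwd m3) (diag _ _ _) _ → there (there (there (here refl)))

solutions[6+n,6+n,1] : ∀ {n} → Solutions n [ 6 + n , 6 + n , true ] (9 + double n) 19
solutions[6+n,6+n,1] {n} = extend (diag true z<s (shift-< 6 7 n))
  (fwd m2c2 ⇒ solutions[4+n,4+n,0] ∷ [])
  ([] ∷ []) λ where
    (fwd m1c1) (diag _ 0<k k<i) ρ → ⊥-elim (too-far-diag-high 5 8 0<k k<i ρ)
    (fwd m2c2) (diag _ _ _) _ → here refl

solutions[7+n,5+n,0] : ∀ {n} → Solutions n [ 7 + n , 5 + n , false ] (10 + double n) 19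
solutions[7+n,5+n,0] {n} = extend (colᵢ false (shift-≤ 5 7 n))
  (bwd c1 ⇒ solutions[7+n,6+n,1] ∷ [])
  ([] ∷ []) λ where
    (bwd c1) (colᵢ _ _) _ → here refl
    (bwd c2) (colᵢ _ _) ρ → ⊥-elim (too-far-colᵢ true 0 9 refl ρ)
    (bwd c2) (diag _ _ k<i) _ → ⊥-elim (m+n≮n 0 _ k<i)
    (bwd c3) (colᵢ _ c≤i) _ → ⊥-elim (m+n≮n 0 _ c≤i)
    (bwd c4) (colᵢ _ c≤i) _ → ⊥-elim (m+n≮n 1 _ c≤i)

solutions[7+n,4+n,0] : ∀ {n} → Solutions n [ 7 + n , 4 + n , false ] (10 + double n) 76
solutions[7+n,4+n,0] {n} = extend (colᵢ false (shift-≤ 4 7 n))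
  (bwd c1 ⇒ solutions[7+n,5+n,1] ∷ bwd c2 ⇒ solutions[7+n,6+n,1] ∷ [])
  (((λ ()) ∷ []) ∷ [] ∷ []) λ where
    (bwd c1) (colᵢ _ _) _ → here refl
    (bwd c2) (colᵢ _ _) _ → there (here refl)
    (bwd c3) (colᵢ _ _) ρ → ⊥-elim (too-far-colᵢ true 0 9 refl ρ)
    (bwd c3) (diag _ _ k<i) _ → ⊥-elim (m+n≮n 0 _ k<i)
    (bwd c4) (colᵢ _ c≤i) _ → ⊥-elim (m+n≮n 0 _ c≤i)

solutions[7+n,3+n,0] : ∀ {n} → Solutions n [ 7 + n , 3 + n , false ] (10 + double n) 152
solutions[7+n,3+n,0] {n} = extend (colᵢ false (shift-≤ 3 7 n))
  ( bwd c1 ⇒ solutions[7+n,4+n,1]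
  ∷ bwd c2 ⇒ solutions[7+n,5+n,1]
  ∷ bwd c3 ⇒ solutions[7+n,6+n,1]
  ∷ [])
  (((λ ()) ∷ (λ ()) ∷ []) ∷ ((λ ()) ∷ []) ∷ [] ∷ []) λ where
    (bwd c1) (colᵢ _ _) _ → here refl
    (bwd c2) (colᵢ _ _) _ → there (here refl)
    (bwd c3) (colᵢ _ _) _ → there (there (here refl))
    (bwd c4) (colᵢ _ _) ρ → ⊥-elim (too-far-colᵢ true 0 9 refl ρ)
    (bwd c4) (diag _ _ k<i) _ → ⊥-elim (m+n≮n 0 _ k<i)

solutions[6+n,6+n,0] : ∀ {n} → Solutions n [ 6 + n , 6 + n , false ] (10 + double n) 19
solutions[6+n,6+n,0] {n} = extend (diag false z<s (shift-< 6 7 n))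
  (bwd m1 ⇒ solutions[7+n,6+n,1] ∷ [])
  ([] ∷ []) λ where
    (bwd m1) (colᵢ _ _) _ → here refl
    (bwd m1c1) (colᵢ _ _) ρ → ⊥-elim (too-far-colᵢ true 0 9 refl ρ)
    (bwd m1c1) (diag _ _ k<i) _ → ⊥-elim (m+n≮n 0 _ k<i)
    (bwd m2c2) (diag _ _ k<i) _ → ⊥-elim (m+n≮n 1 _ k<i)

solutions[5+n,5+n,0] : ∀ {n} → Solutions n [ 5 + n , 5 + n , false ] (10 + double n) 95
solutions[5+n,5+n,0] {n} = extend (diag false z<s (shift-< 5 7 n))
  ( bwd m2 ⇒ solutions[7+n,5+n,1]
  ∷ bwd m1c1 ⇒ solutions[6+n,6+n,1]
  ∷ bwd m2c1 ⇒ solutions[7+n,6+n,1]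
  ∷ [])
  (((λ ()) ∷ (λ ()) ∷ []) ∷ ((λ ()) ∷ []) ∷ [] ∷ []) λ where
    (bwd m2) (colᵢ _ _) _ → here refl
    (bwd m1c1) (diag _ _ _) _ → there (here refl)
    (bwd m2c1) (colᵢ _ _) _ → there (there (here refl))
    (bwd m2c2) (colᵢ _ _) ρ → ⊥-elim (too-far-colᵢ true 0 9 refl ρ)
    (bwd m2c2) (diag _ _ k<i) _ → ⊥-elim (m+n≮n 0 _ k<i)

solutions[7+n,7+n,1] : ∀ {n} → Solutions n [ 7 + n , 7 + n , true ] (11 + double n) 361
solutions[7+n,7+n,1] {n} = extend (colᵢ true (shift-≤ 7 7 n))
  ( fwd c2 ⇒ solutions[7+n,5+n,0]
  ∷ fwd c3 ⇒ solutions[7+n,4+n,0]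
  ∷ fwd c4 ⇒ solutions[7+n,3+n,0]
  ∷ fwd m1c1 ⇒ solutions[6+n,6+n,0]
  ∷ fwd m2c2 ⇒ solutions[5+n,5+n,0]
  ∷ [])
  ( ((λ ()) ∷ (λ ()) ∷ (λ ()) ∷ (λ ()) ∷ [])
  ∷ ((λ ()) ∷ (λ ()) ∷ (λ ()) ∷ [])
  ∷ ((λ ()) ∷ (λ ()) ∷ [])
  ∷ ((λ ()) ∷ [])
  ∷ [] ∷ []) λ where
    (fwd c1) (colᵢ _ _) ρ → ⊥-elim (too-far-colᵢ false 1 10 refl ρ)
    (fwd c2) (colᵢ _ _) _ → here refl
    (fwd c3) (colᵢ _ _) _ → there (here refl)
    (fwd c4) (colᵢ _ _) _ → there (there (here refl))
    (fwd m1c1) (diag _ _ _) _ → there (there (there (here refl)))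
    (fwd m2c2) (diag _ _ _) _ → there (there (there (there (here refl))))

shortest-crossings : ∀ {n xs} → Walk (Edge′ n) (start (7 + n) (7 + n)) goal xs → 11 + double n ≤ crossings xs
shortest-crossings {n} w = subst (_≤ _) (potential-colᵢ true 0 refl) (reach-bound (_ , w , refl))

solution-count : ∀ n → NumSolutions (7 + n) (7 + n) 4 (+ 0) 361
solution-count n =
  11 + double n , (λ _ → shortest-crossings) ,
  walks S , distinct S , (λ _ → sound S) , (λ _ → complete S) , count S
  where S = solutions[7+n,7+n,1] {n}

mainTheorem1 : (i : ℕ) → 7 ≤ i → NumSolutions i i 4 (+ 0) 361
mainTheorem1 i 7≤i with m≤n⇒∃[o]m+o≡n 7≤i
... | n , refl = solution-count n
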